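{- Let $(T,\mu,\eta)$ be a monad on a category $\mathsf{C}$ with $\mathcal{K}l(T)$ order enriched, and assume: (a) the inclusion $\mathsf{C}^*_{T,\le}\to\mathsf{C}_{T,\le}$ has a left adjoint $(-)^*$; (b) $(-)^*$ sends homomorphisms to homomorphisms, i.e. restricts to a functor $\mathsf{C}_T\to\mathsf{C}^*_T$; (c) $(-)^*$ is the identity on morphisms (so it sends a coalgebra $\alpha$ on $X$ to a coalgebra $\alpha^*$ on $X$ and each morphism $f$ to $f$). Assume $\mathsf{C}_T$ has a final object $\zeta:Z\to TZ$, write $\mathsf{beh}_\alpha$ for the unique homomorphism from $\alpha$ to $\zeta$, and put $\mathsf{wbeh}_\alpha:=\mathsf{beh}_{\alpha^*}$. Then for every $\alpha:X\to TX$, $\mathsf{wbeh}_\alpha=\mathsf{beh}_{\alpha^*}=\mathsf{beh}_{\zeta^*}\circ\mathsf{beh}_\alpha=\mathsf{wbeh}_\zeta\circ\mathsf{beh}_\alpha$.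
   Context: $\mathcal{K}l(T)$: morphisms $X\rightsquigarrow Y$ are morphisms $X\to TY$, composition $g\cdot f=\mu_Z\circ Tg\circ f$, identity $1_X=\eta_X$; order enriched means hom-sets are posets and composition is monotone. $\mathsf{C}_T$: $T$-coalgebras $\alpha:X\to TX$ with homomorphisms $f$ satisfying $Tf\circ\alpha=\beta\circ f$. $\mathsf{C}_{T,\le}$: $T$-coalgebras with lax homomorphisms $f:X\to Y$, i.e. $Tf\circ\alpha\le\beta\circ f$ in the order of $\mathcal{K}l(T)$. $\mathsf{C}^*_{T,\le}$: full subcategory of $\mathsf{C}_{T,\le}$ on coalgebras with $1_X\le\alpha$ and $\alpha\cdot\alpha\le\alpha$. $\mathsf{C}^*_T$: same objects as $\mathsf{C}^*_{T,\le}$, with homomorphisms of $\mathsf{C}_T$. -}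

module Defs where

open import Level using (Level; _⊔_) renaming (suc to lsuc)
open import Data.Product using (Σ; _×_; _,_)
open import Relation.Binary.PropositionalEquality using (_≡_)
open import Relation.Binary.Structures using (IsPartialOrder)

record Category (o ℓ : Level) : Set (lsuc (o ⊔ ℓ)) where
  infixr 9 _∘_
  field
    Obj : Set o
    Hom : Obj → Obj → Set ℓ
    id  : ∀ {A} → Hom A A
    _∘_ : ∀ {A B C} → Hom B C → Hom A B → Hom A C
    identityˡ : ∀ {A B} {f : Hom A B} → id ∘ f ≡ f
    identityʳ : ∀ {A B} {f : Hom A B} → f ∘ id ≡ f
    assoc : ∀ {A B C D} {f : Hom A B} {g : Hom B C} {h : Hom C D} →
            (h ∘ g) ∘ f ≡ h ∘ (g ∘ f)

record Monad {o ℓ : Level} (C : Category o ℓ) : Set (o ⊔ ℓ) where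
  open Category C
  field
    T    : Obj → Obj
    fmap : ∀ {A B} → Hom A B → Hom (T A) (T B)
    fmap-id : ∀ {A} → fmap (id {A}) ≡ id
    fmap-∘  : ∀ {A B D} {f : Hom A B} {g : Hom B D} → fmap (g ∘ f) ≡ fmap g ∘ fmap f
    η : ∀ {A} → Hom A (T A)
    μ : ∀ {A} → Hom (T (T A)) (T A)
    η-natural : ∀ {A B} {f : Hom A B} → fmap f ∘ η ≡ η ∘ f
    μ-natural : ∀ {A B} {f : Hom A B} → fmap f ∘ μ ≡ μ ∘ fmap (fmap f)
    identityˡ-μ : ∀ {A} → μ ∘ η {T A} ≡ id
    identityʳ-μ : ∀ {A} → μ ∘ fmap (η {A}) ≡ id
    assoc-μ : ∀ {A} → μ ∘ fmap (μ {A}) ≡ μ ∘ μ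

  infixr 9 _·_
  _·_ : ∀ {X Y Z} → Hom Y (T Z) → Hom X (T Y) → Hom X (T Z)
  g · f = μ ∘ (fmap g ∘ f)

record KleisliOrder {o ℓ : Level} {C : Category o ℓ} (M : Monad C) (r : Level)
       : Set (o ⊔ ℓ ⊔ lsuc r) where
  open Category C
  open Monad M
  field
    _≤_ : ∀ {X Y} → Hom X (T Y) → Hom X (T Y) → Set r
    isPartialOrder : ∀ {X Y} → IsPartialOrder (_≡_ {A = Hom X (T Y)}) _≤_
    ·-mono : ∀ {X Y Z} {f f′ : Hom X (T Y)} {g g′ : Hom Y (T Z)} →
             f ≤ f′ → g ≤ g′ → (g · f) ≤ (g′ · f′)

module Coalgebras {o ℓ r : Level} (C : Category o ℓ) (M : Monad C)
                  (O : KleisliOrder M r) where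
  open Category C
  open Monad M
  open KleisliOrder O

  record Coalg : Set (o ⊔ ℓ) where
    constructor coalg
    field
      carrier : Obj
      str     : Hom carrier (T carrier)
  open Coalg public

  IsHom : (α β : Coalg) → Hom (carrier α) (carrier β) → Set ℓ
  IsHom α β f = fmap f ∘ str α ≡ str β ∘ f

  IsLax : (α β : Coalg) → Hom (carrier α) (carrier β) → Set r
  IsLax α β f = (fmap f ∘ str α) ≤ (str β ∘ f)

  IsStar : Coalg → Set r
  IsStar α = (η ≤ str α) × ((str α · str α) ≤ str α)

  -- Assumptions (a) and (c): a left adjoint (-)* to the (full) inclusion
  -- C*_{T,≤} → C_{T,≤} that keeps carriers and is the identity on morphisms.
  -- The adjunction is given by its unit and universal property.
  record StarAdjunction : Set (o ⊔ ℓ ⊔ r) where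
    field
      star : (α : Coalg) → Hom (carrier α) (T (carrier α))
    _* : Coalg → Coalg
    α * = coalg (carrier α) (star α)
    field
      star-isStar : ∀ α → IsStar (α *)
      star-lax : ∀ α β (f : Hom (carrier α) (carrier β)) →
                 IsLax α β f → IsLax (α *) (β *) f
      unit : ∀ α → Hom (carrier α) (carrier α)
      unit-lax : ∀ α → IsLax α (α *) (unit α)
      unit-natural : ∀ α β (f : Hom (carrier α) (carrier β)) →
                     IsLax α β f → f ∘ unit α ≡ unit β ∘ f
      universal : ∀ α β → IsStar β → (f : Hom (carrier α) (carrier β)) →
                  IsLax α β f →
                  Σ (Hom (carrier α) (carrier β)) λ g →
                    IsLax (α *) β g × (g ∘ unit α ≡ f) ×
                    (∀ g′ → IsLax (α *) β g′ → g′ ∘ unit α ≡ f → g′ ≡ g)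

  PreservesHoms : StarAdjunction → Set (o ⊔ ℓ)
  PreservesHoms S = ∀ α β (f : Hom (carrier α) (carrier β)) →
                    IsHom α β f → IsHom (α *) (β *) f
    where open StarAdjunction S

  record Final : Set (o ⊔ ℓ) where
    field
      ζ : Coalg
      beh : ∀ α → Hom (carrier α) (carrier ζ)
      beh-hom : ∀ α → IsHom α ζ (beh α)
      beh-unique : ∀ α (f : Hom (carrier α) (carrier ζ)) → IsHom α ζ f → f ≡ beh α

  wbeh : StarAdjunction → (F : Final) → ∀ α → Hom (carrier α) (carrier (Final.ζ F))
  wbeh S F α = Final.beh F (StarAdjunction._* S α)

module Submission where

open import Defs
open import Level using (Level)
open import Data.Product using (_×_; _,_)
open import Relation.Binary.PropositionalEquality using (_≡_; refl; sym; cong; module ≡-Reasoning)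

-- Since (-)* preserves homomorphisms and is the identity on morphisms, beh α is also a
-- homomorphism α* → ζ*; composed with beh ζ* it is a homomorphism α* → ζ, so by
-- finality it equals beh α*.

module _ {o ℓ r : Level} (C : Category o ℓ) (M : Monad C) (O : KleisliOrder M r) where
  open Category C
  open Monad M
  open Coalgebras C M O

  isHom-∘ : ∀ {α β γ : Coalg} {f : Hom (carrier α) (carrier β)} {g : Hom (carrier β) (carrier γ)} →
            IsHom α β f → IsHom β γ g → IsHom α γ (g ∘ f)
  isHom-∘ {α} {β} {γ} {f} {g} f-hom g-hom = begin
    fmap (g ∘ f) ∘ str α     ≡⟨ cong (_∘ str α) fmap-∘ ⟩
    (fmap g ∘ fmap f) ∘ str α ≡⟨ assoc ⟩
    fmap g ∘ (fmap f ∘ str α) ≡⟨ cong (fmap g ∘_) f-hom ⟩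
    fmap g ∘ (str β ∘ f)      ≡⟨ sym assoc ⟩
    (fmap g ∘ str β) ∘ f      ≡⟨ cong (_∘ f) g-hom ⟩
    (str γ ∘ g) ∘ f           ≡⟨ assoc ⟩
    str γ ∘ (g ∘ f)           ∎
    where open ≡-Reasoning

  beh-star-factors : (S : StarAdjunction) → PreservesHoms S → (F : Final) →
                     let open StarAdjunction S
                         open Final F
                     in ∀ α → beh (α *) ≡ beh (ζ *) ∘ beh α
  beh-star-factors S preserves F α =
    sym (beh-unique (α *) (beh (ζ *) ∘ beh α)
          (isHom-∘ (preserves α ζ (beh α) (beh-hom α)) (beh-hom (ζ *))))
    where
      open StarAdjunction S
      open Final F

theorem7p2 : ∀ {o ℓ r : Level} (C : Category o ℓ) (M : Monad C) (O : KleisliOrder M r) →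
    let open Category C
        open Coalgebras C M O
    in (S : StarAdjunction) → PreservesHoms S → (F : Final) →
    let open StarAdjunction S
        open Final F
    in ∀ (α : Coalg) →
      (wbeh S F α ≡ beh (α *))
      × (beh (α *) ≡ beh (ζ *) ∘ beh α)
      × (beh (ζ *) ∘ beh α ≡ wbeh S F ζ ∘ beh α)
theorem7p2 C M O S preserves F α = refl , beh-star-factors C M O S preserves F α , refl
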